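{- Let $G$ be a finite simple graph, $k\ge 2$, $v\notin V(G)$, and let $G\sqcup v$ be the graph consisting of $G$ and the additional isolated vertex $v$. Then $\Delta_k^t(G\sqcup v) = \Delta^t_{k-1}(G) \cup (\Delta_k^t(G)\ast v)$.
   Context: For $j\ge 1$, the total $j$-cut complex $\Delta_j^t(G)$ is the simplicial complex on $V(G)$ whose facets are the complements $V(G)\setminus S$ of independent sets $S$ of size $j$ in $G$ (void if there are none). For a complex $\Delta$ and a new vertex $v$, $\Delta* v=\{\sigma,\ \sigma\cup\{v\}:\sigma\in\Delta\}$ is the cone over $\Delta$ (void if $\Delta$ is void). -}

module Defs where

open import Data.Nat using (ℕ; zero; suc; _∸_)
open import Data.Fin using (Fin; zero; suc)
open import Data.Fin.Subset using (Subset; _∈_; _⊆_; ∁; ∣_∣)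
open import Data.Vec using (_∷_)
open import Data.Bool using (Bool; false)
open import Data.Empty using (⊥)
open import Data.Sum using (_⊎_)
open import Data.Product using (Σ; ∃; _×_)
open import Relation.Nullary using (¬_)
open import Relation.Binary.PropositionalEquality using (_≡_)

record Graph (n : ℕ) : Set₁ where
  field
    Adj   : Fin n → Fin n → Set
    sym   : ∀ x y → Adj x y → Adj y x
    irrfl : ∀ x → ¬ Adj x x
open Graph public

-- A simplicial complex on vertex set Fin n, given by its face predicate
-- (the void complex is the everywhere-empty predicate).
Complex : ℕ → Set₁
Complex n = Subset n → Set

Independent : ∀ {n} → Graph n → Subset n → Set
Independent G S = ∀ {x y} → x ∈ S → y ∈ S → ¬ Adj G x y

-- Total j-cut complex: generated by the facets V(G) ∖ S, S independent, |S| = j.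
-- σ is a face iff σ ⊆ V(G) ∖ S for some independent S of size j.
totalCut : ∀ {n} → ℕ → Graph n → Complex n
totalCut j G σ = Σ (Subset _) λ S → Independent G S × ∣ S ∣ ≡ j × σ ⊆ ∁ S

-- G ⊔ v : vertex set Fin (suc n), the new isolated vertex v is `zero`,
-- old vertex x of G is `suc x`.
addIsolated : ∀ {n} → Graph n → Graph (suc n)
addIsolated {n} G = record { Adj = A ; sym = s ; irrfl = i }
  where
  A : Fin (suc n) → Fin (suc n) → Set
  A zero    _       = ⊥
  A (suc x) zero    = ⊥
  A (suc x) (suc y) = Adj G x y
  s : ∀ x y → A x y → A y x
  s zero    _       ()
  s (suc x) zero    ()
  s (suc x) (suc y) a = sym G x y a
  i : ∀ x → ¬ A x x
  i zero    ()
  i (suc x) a = irrfl G x a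

-- A complex on V(G), regarded as a complex on V(G) ∪ {v} (v = zero).
include : ∀ {n} → Complex n → Complex (suc n)
include Δ (b ∷ τ) = b ≡ false × Δ τ

-- Cone Δ * v = {σ, σ ∪ {v} : σ ∈ Δ} (void if Δ is void).
cone : ∀ {n} → Complex n → Complex (suc n)
cone Δ (b ∷ τ) = Δ τ

_∪C_ : ∀ {n} → Complex n → Complex n → Complex n
(Δ ∪C Γ) σ = Δ σ ⊎ Γ σ

_≡C_ : ∀ {n} → Complex n → Complex n → Set
Δ ≡C Γ = ∀ σ → (Δ σ → Γ σ) × (Γ σ → Δ σ)

{-# OPTIONS --safe #-}
module Submission where

open import Defs
open import Data.Nat using (ℕ; suc; _≤_; _∸_)
open import Data.Fin.Subset using (Subset; Side; inside; outside; _⊆_)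
open import Data.Fin.Subset.Properties using (drop-∷-⊆; out⊆; s⊆s)
open import Data.Vec.Base using (_∷_; here; there)
open import Data.Sum using (inj₁; inj₂; [_,_])
open import Data.Product using (_,_)
open import Relation.Binary.PropositionalEquality using (refl)

infix 4 _⊆C_

_⊆C_ : ∀ {n} → Complex n → Complex n → Set
Δ ⊆C Γ = ∀ σ → Δ σ → Γ σ

∪C-least : ∀ {n} {Δ Γ Θ : Complex n} → Δ ⊆C Θ → Γ ⊆C Θ → Δ ∪C Γ ⊆C Θ
∪C-least Δ⊆Θ Γ⊆Θ σ = [ Δ⊆Θ σ , Γ⊆Θ σ ]

⊆-inside : ∀ {n} {s : Side} {p q : Subset n} → p ⊆ q → s ∷ p ⊆ inside ∷ q
⊆-inside {s = inside}  = s⊆s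
⊆-inside {s = outside} = out⊆

module _ {n} (G : Graph n) where

  Independent-addIsolated⁻ : ∀ {s} {S : Subset n} →
    Independent (addIsolated G) (s ∷ S) → Independent G S
  Independent-addIsolated⁻ ind x∈S y∈S = ind (there x∈S) (there y∈S)

  Independent-addIsolated⁺ : ∀ {s} {S : Subset n} →
    Independent G S → Independent (addIsolated G) (s ∷ S)
  Independent-addIsolated⁺ ind here        _           ()
  Independent-addIsolated⁺ ind (there x∈S) here        ()
  Independent-addIsolated⁺ ind (there x∈S) (there y∈S) = ind x∈S y∈S

  -- A cut S of G ⊔ v either avoids v (a cut of G of the same size, and v is free
  -- in the face) or contains v (a cut of G of one size less, and v is not in the face).
  totalCut-addIsolated-⊆ : ∀ j →
    totalCut (suc j) (addIsolated G) ⊆C include (totalCut j G) ∪C cone (totalCut (suc j) G)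
  totalCut-addIsolated-⊆ j (s ∷ τ) (outside ∷ S , ind , size , σ⊆∁S) =
    inj₂ (S , Independent-addIsolated⁻ ind , size , drop-∷-⊆ σ⊆∁S)
  totalCut-addIsolated-⊆ j (inside ∷ τ) (inside ∷ S , ind , size , σ⊆∁S) with σ⊆∁S here
  ... | ()
  totalCut-addIsolated-⊆ j (outside ∷ τ) (inside ∷ S , ind , refl , σ⊆∁S) =
    inj₁ (refl , S , Independent-addIsolated⁻ ind , refl , drop-∷-⊆ σ⊆∁S)

  include-totalCut-⊆ : ∀ j → include (totalCut j G) ⊆C totalCut (suc j) (addIsolated G)
  include-totalCut-⊆ j (.outside ∷ τ) (refl , S , ind , refl , τ⊆∁S) =
    inside ∷ S , Independent-addIsolated⁺ ind , refl , out⊆ τ⊆∁S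

  cone-totalCut-⊆ : ∀ k → cone (totalCut k G) ⊆C totalCut k (addIsolated G)
  cone-totalCut-⊆ k (s ∷ τ) (S , ind , size , τ⊆∁S) =
    outside ∷ S , Independent-addIsolated⁺ ind , size , ⊆-inside τ⊆∁S

proposition3p2 : ∀ {n} (G : Graph n) (k : ℕ) → 2 ≤ k →
    totalCut k (addIsolated G) ≡C (include (totalCut (k ∸ 1) G) ∪C cone (totalCut k G))
proposition3p2 G (suc j) _ σ =
  totalCut-addIsolated-⊆ G j σ ,
  ∪C-least (include-totalCut-⊆ G j) (cone-totalCut-⊆ G (suc j)) σ
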